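{- The graph $F(9,15,23)$ on vertex set $\{1,\dots,9\}$ with edges $\{1,2\},\{2,4\},\{3,4\},\{1,3\},\{8,9\},\{1,6\},\{2,6\},\{6,7\},\{6,9\},\{7,9\},\{3,5\},\{4,5\},\{5,7\},\{5,8\},\{7,8\}$ is forbidden.
   Context: All graphs are finite and simple. A graph $G$ with vertex set $V$ is unit-distance if there exists an injective map $\varphi\colon V\to\mathbf{R}^2$ with $|\varphi(v)-\varphi(w)|=1$ for every pair of adjacent vertices $v,w$ (non-adjacent vertices may also be at distance 1). A graph is forbidden if it is not unit-distance. -}

module Defs where

open import Level using (Level; _⊔_) renaming (suc to lsuc; zero to 0ℓ)
open import Data.Nat using (ℕ; suc)
open import Data.Fin using (Fin; #_)
open import Data.Product using (_×_; _,_; ∃; ∃-syntax; Σ)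
open import Data.Sum using (_⊎_)
open import Data.List using (List; []; _∷_)
open import Data.List.Membership.Propositional using (_∈_)
open import Relation.Binary.PropositionalEquality using (_≡_)
open import Relation.Nullary using (¬_)
open import Relation.Binary.Structures using (IsTotalOrder)
open import Algebra.Bundles using (CommutativeRing)

-- A (Dedekind-)complete ordered field: the real numbers, characterised up to
-- isomorphism.  Equality is the setoid equality _≈_ of the ring.
record CompleteOrderedField (c ℓ : Level) : Set (lsuc (c ⊔ ℓ)) where
  field
    commRing : CommutativeRing c ℓ
  open CommutativeRing commRing public
  field
    _≤_           : Carrier → Carrier → Set ℓ
    ≤-isTotalOrder : IsTotalOrder _≈_ _≤_
    +-mono-≤      : ∀ {x y} z → x ≤ y → (x + z) ≤ (y + z)
    *-nonneg      : ∀ {x y} → 0# ≤ x → 0# ≤ y → 0# ≤ (x * y)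
    0≉1           : ¬ (0# ≈ 1#)
    inverse       : ∀ x → ¬ (x ≈ 0#) → ∃[ y ] (x * y ≈ 1#)
    complete      : (P : Carrier → Set ℓ) → ∃ P →
                    ∃[ b ] (∀ x → P x → x ≤ b) →
                    ∃[ s ] ((∀ x → P x → x ≤ s) ×
                            (∀ b → (∀ x → P x → x ≤ b) → s ≤ b))

record Graph (n : ℕ) : Set where
  constructor graph
  field
    edges : List (Fin n × Fin n)

Adj : ∀ {n} → Graph n → Fin n → Fin n → Set
Adj G v w = ((v , w) ∈ Graph.edges G) ⊎ ((w , v) ∈ Graph.edges G)

module _ {c ℓ : Level} (R : CompleteOrderedField c ℓ) where
  open CompleteOrderedField R

  Point : Set c
  Point = Carrier × Carrier

  _≈ₚ_ : Point → Point → Set ℓ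
  (x₁ , y₁) ≈ₚ (x₂ , y₂) = (x₁ ≈ x₂) × (y₁ ≈ y₂)

  -- squared Euclidean distance; |p - q| = 1 iff |p - q|² = 1
  dist² : Point → Point → Carrier
  dist² (x₁ , y₁) (x₂ , y₂) =
    ((x₁ - x₂) * (x₁ - x₂)) + ((y₁ - y₂) * (y₁ - y₂))

  UnitDistance : ∀ {n} → Graph n → Set (c ⊔ ℓ)
  UnitDistance {n} G =
    Σ (Fin n → Point) λ φ →
      (∀ v w → φ v ≈ₚ φ w → v ≡ w) ×
      (∀ v w → Adj G v w → dist² (φ v) (φ w) ≈ 1#)

-- The graph F(9,15,23).  Paper vertex i (1 ≤ i ≤ 9) is  # (i - 1) : Fin 9.
-- Paper edges: {1,2},{2,4},{3,4},{1,3},{8,9},{1,6},{2,6},{6,7},{6,9},{7,9},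
--              {3,5},{4,5},{5,7},{5,8},{7,8}
F-9-15-23 : Graph 9
F-9-15-23 = graph
  ( (# 0 , # 1)
  ∷ (# 1 , # 3)
  ∷ (# 2 , # 3)
  ∷ (# 0 , # 2)
  ∷ (# 7 , # 8)
  ∷ (# 0 , # 5)
  ∷ (# 1 , # 5)
  ∷ (# 5 , # 6)
  ∷ (# 5 , # 8)
  ∷ (# 6 , # 8)
  ∷ (# 2 , # 4)
  ∷ (# 3 , # 4)
  ∷ (# 4 , # 6)
  ∷ (# 4 , # 7)
  ∷ (# 6 , # 7)
  ∷ [] )

Forbidden : ∀ {c ℓ} → CompleteOrderedField c ℓ → ∀ {n} → Graph n → Set (c ⊔ ℓ)
Forbidden R G = ¬ UnitDistance R G

-- Number the vertices 0, …, 8 (paper vertex i is i - 1).  In a unit-distance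
-- embedding p, the 4-cycle 0 1 3 2 is a rhombus with unit sides, and 5 and 4
-- are apexes of unit equilateral triangles over its opposite sides 01 and 23.
-- The triangle 6 7 8 is equilateral, and 5, 4 are the reflections of 7, 8 in
-- the lines 68, 67; hence p₅ - p₄ = 2 (p₈ - p₇) has length 2.  We show that
-- two such apexes are never at distance 2, which gives the contradiction.
module Submission where

open import Defs
open import Level using (Level; 0ℓ)

open import Algebra.Bundles using (CommutativeRing)
import Algebra.Solver.Ring.AlmostCommutativeRing as ACR
open import Data.Nat as ℕ using (ℕ; zero; suc)
import Data.Nat.Properties as ℕP
open import Data.Integer as ℤ using (ℤ; +_; -[1+_]; _⊖_)
import Data.Integer.Properties as ℤP
open import Data.Sign as Sign using (Sign)
open import Data.Maybe using (map)
open import Relation.Binary.PropositionalEquality as ≡ using (_≡_)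
open import Relation.Binary.Consequences using (dec⇒weaklyDec)
open import Relation.Binary.Structures using (IsTotalOrder)
open import Relation.Nullary using (¬_)
open import Data.Product using (_,_; proj₁; proj₂)
open import Data.Sum using (inj₁; inj₂)
open import Data.Fin as Fin using (#_)
import Data.Product.Properties as ProductP
open import Data.List.Membership.DecPropositional (ProductP.≡-dec (Fin._≟_ {9}) (Fin._≟_ {9})) using (_∈?_)
open import Relation.Nullary.Decidable using (Dec; True; toWitness; _⊎-dec_)
import Data.Product as Product

-- The ring solver of the standard library for an arbitrary commutative
-- ring, with integer coefficients.  It is instantiated through the
-- canonical ring homomorphism ℤ → R, n ↦ n·1.
module IntegerCoefficientSolver {c ℓ : Level} (R : CommutativeRing c ℓ) where
  open CommutativeRing R
  open import Algebra.Properties.Ring ring using (-0#≈0#; -‿involutive; -‿distribˡ-*; -‿distribʳ-*; -‿+-comm)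
  open import Algebra.Properties.Semiring.Mult.TCOptimised semiring using (_×_; ×-homo-+; ×1-homo-*; 1+×)
  open import Algebra.Properties.CommutativeSemigroup +-commutativeSemigroup using (interchange)
  open import Relation.Binary.Reasoning.Setoid setoid

  -- The canonical homomorphism; with the optimised n × x, the constants
  -- 0, 1, 2, … are sent to 0#, 1#, 1# + 1#, … definitionally.
  ⟦_⟧ℤ : ℤ → Carrier
  ⟦ + n ⟧ℤ     = n × 1#
  ⟦ -[1+ n ] ⟧ℤ = - (suc n × 1#)

  ⊖-homo : ∀ m n → ⟦ m ⊖ n ⟧ℤ ≈ m × 1# - n × 1#
  ⊖-homo m zero rewrite ℤP.⊖-≥ {m} {0} ℕ.z≤n = sym (begin
    m × 1# - 0#       ≈⟨ +-congˡ -0#≈0# ⟩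
    m × 1# + 0#       ≈⟨ +-identityʳ _ ⟩
    m × 1#            ∎)
  ⊖-homo zero (suc n) = sym (+-identityˡ _)
  ⊖-homo (suc m) (suc n) rewrite ℤP.[1+m]⊖[1+n]≡m⊖n m n = begin
    ⟦ m ⊖ n ⟧ℤ                ≈⟨ ⊖-homo m n ⟩
    a - b                     ≈⟨ sym (+-identityˡ _) ⟩
    0# + (a - b)              ≈⟨ +-congʳ (sym (-‿inverseʳ 1#)) ⟩
    (1# - 1#) + (a - b)       ≈⟨ interchange 1# (- 1#) a (- b) ⟩
    (1# + a) + (- 1# + - b)   ≈⟨ +-cong (sym (1+× m 1#)) (-‿+-comm 1# b) ⟩
    suc m × 1# - (1# + b)     ≈⟨ +-congˡ (-‿cong (sym (1+× n 1#))) ⟩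
    suc m × 1# - suc n × 1#   ∎
    where
    a b : Carrier
    a = m × 1#
    b = n × 1#

  +-homo : ∀ i j → ⟦ i ℤ.+ j ⟧ℤ ≈ ⟦ i ⟧ℤ + ⟦ j ⟧ℤ
  +-homo -[1+ m ] -[1+ n ] = begin
    - (suc (suc (m ℕ.+ n)) × 1#)          ≈⟨ -‿cong (reflexive (≡.cong (λ k → suc k × 1#) (≡.sym (ℕP.+-suc m n)))) ⟩
    - ((suc m ℕ.+ suc n) × 1#)            ≈⟨ -‿cong (×-homo-+ 1# (suc m) (suc n)) ⟩
    - (suc m × 1# + suc n × 1#)           ≈⟨ sym (-‿+-comm _ _) ⟩
    - (suc m × 1#) + - (suc n × 1#)       ∎
  +-homo -[1+ m ] (+ n) = trans (⊖-homo n (suc m)) (+-comm _ _)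
  +-homo (+ m) -[1+ n ] = ⊖-homo m (suc n)
  +-homo (+ m) (+ n)    = ×-homo-+ 1# m n

  -‿homo : ∀ i → ⟦ ℤ.- i ⟧ℤ ≈ - ⟦ i ⟧ℤ
  -‿homo (+ zero)  = sym -0#≈0#
  -‿homo (+ suc n) = refl
  -‿homo -[1+ n ]  = sym (-‿involutive _)

  -- Multiplication is handled through the sign-magnitude decomposition
  -- i * j = (sign i · sign j) ◃ (∣i∣ · ∣j∣).
  signed : Sign → Carrier → Carrier
  signed Sign.+ x = x
  signed Sign.- x = - x

  ◃-homo : ∀ s n → ⟦ s ℤ.◃ n ⟧ℤ ≈ signed s (n × 1#)
  ◃-homo Sign.+ zero    = refl
  ◃-homo Sign.- zero    = sym -0#≈0#
  ◃-homo Sign.+ (suc n) = refl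
  ◃-homo Sign.- (suc n) = refl

  signed-abs : ∀ i → ⟦ i ⟧ℤ ≈ signed (ℤ.sign i) (ℤ.∣ i ∣ × 1#)
  signed-abs (+ n)    = refl
  signed-abs -[1+ n ] = refl

  signed-* : ∀ s t x y → signed (s Sign.* t) (x * y) ≈ signed s x * signed t y
  signed-* Sign.+ Sign.+ x y = refl
  signed-* Sign.+ Sign.- x y = -‿distribʳ-* x y
  signed-* Sign.- Sign.+ x y = -‿distribˡ-* x y
  signed-* Sign.- Sign.- x y = begin
    x * y          ≈⟨ sym (-‿involutive _) ⟩
    - - (x * y)    ≈⟨ -‿cong (-‿distribˡ-* x y) ⟩
    - (- x * y)    ≈⟨ -‿distribʳ-* (- x) y ⟩
    - x * - y      ∎

  signed-cong : ∀ s {x y} → x ≈ y → signed s x ≈ signed s y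
  signed-cong Sign.+ e = e
  signed-cong Sign.- e = -‿cong e

  *-homo : ∀ i j → ⟦ i ℤ.* j ⟧ℤ ≈ ⟦ i ⟧ℤ * ⟦ j ⟧ℤ
  *-homo i j = begin
    ⟦ i ℤ.* j ⟧ℤ                                ≈⟨ ◃-homo (s Sign.* t) (m ℕ.* n) ⟩
    signed (s Sign.* t) ((m ℕ.* n) × 1#)       ≈⟨ signed-cong (s Sign.* t) (×1-homo-* m n) ⟩
    signed (s Sign.* t) (m × 1# * n × 1#)      ≈⟨ signed-* s t _ _ ⟩
    signed s (m × 1#) * signed t (n × 1#)      ≈⟨ *-cong (sym (signed-abs i)) (sym (signed-abs j)) ⟩
    ⟦ i ⟧ℤ * ⟦ j ⟧ℤ                             ∎
    where
    s t : Sign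
    s = ℤ.sign i
    t = ℤ.sign j
    m n : ℕ
    m = ℤ.∣ i ∣
    n = ℤ.∣ j ∣

  homomorphism : ℤ.+-*-rawRing ACR.-Raw-AlmostCommutative⟶ ACR.fromCommutativeRing R
  homomorphism = record
    { ⟦_⟧ = ⟦_⟧ℤ ; +-homo = +-homo ; *-homo = *-homo ; -‿homo = -‿homo
    ; 0-homo = refl ; 1-homo = refl }

  open import Algebra.Solver.Ring ℤ.+-*-rawRing (ACR.fromCommutativeRing R) homomorphism
    (λ i j → map (λ i≡j → reflexive (≡.cong ⟦_⟧ℤ i≡j)) (dec⇒weaklyDec ℤ._≟_ i j)) public

module OrderedFieldFacts {f ℓ : Level} (F : CompleteOrderedField f ℓ) where
  open CompleteOrderedField F
  open IsTotalOrder ≤-isTotalOrder using (total; antisym) renaming (refl to ≤-refl; trans to ≤-trans; ≤-respˡ-≈ to ≤-respˡ; ≤-respʳ-≈ to ≤-respʳ)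
  open import Algebra.Properties.Semiring.Mult.TCOptimised semiring using (_×_; 1+×)
  open IntegerCoefficientSolver commRing using (solve; _:=_; _:+_; _:*_; _:-_; :-_; con)
  open import Relation.Binary.Reasoning.Setoid setoid

  -- The image of a natural number in F; this is also how the solver
  -- interprets the integer constant  con (+ n).
  fromℕ : ℕ → Carrier
  fromℕ n = n × 1#

  cancelˡ : ∀ {x y} → ¬ (x ≈ 0#) → x * y ≈ 0# → y ≈ 0#
  cancelˡ {x} {y} x≉0 xy≈0 = begin
    y                 ≈⟨ sym (*-identityˡ y) ⟩
    1# * y            ≈⟨ *-congʳ (sym xx⁻¹≈1) ⟩
    (x * x⁻¹) * y     ≈⟨ *-congʳ (*-comm x x⁻¹) ⟩
    (x⁻¹ * x) * y     ≈⟨ *-assoc x⁻¹ x y ⟩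
    x⁻¹ * (x * y)     ≈⟨ *-congˡ xy≈0 ⟩
    x⁻¹ * 0#          ≈⟨ zeroʳ x⁻¹ ⟩
    0#                ∎
    where
    x⁻¹ : Carrier
    x⁻¹ = proj₁ (inverse x x≉0)
    xx⁻¹≈1 : x * x⁻¹ ≈ 1#
    xx⁻¹≈1 = proj₂ (inverse x x≉0)

  *-nonzero : ∀ {x y} → ¬ (x ≈ 0#) → ¬ (y ≈ 0#) → ¬ (x * y ≈ 0#)
  *-nonzero x≉0 y≉0 xy≈0 = y≉0 (cancelˡ x≉0 xy≈0)

  ≤-+-nonneg : ∀ {x y} → 0# ≤ x → y ≤ (x + y)
  ≤-+-nonneg {x} {y} 0≤x = ≤-respˡ (+-identityˡ y) (+-mono-≤ y 0≤x)

  square-nonneg : ∀ a → 0# ≤ (a * a)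
  square-nonneg a with total 0# a
  ... | inj₁ 0≤a = *-nonneg 0≤a 0≤a
  ... | inj₂ a≤0 = ≤-respʳ (solve 1 (λ a → :- a :* :- a := a :* a) refl a) (*-nonneg 0≤-a 0≤-a)
    where
    0≤-a : 0# ≤ (- a)
    0≤-a = ≤-respˡ (-‿inverseʳ a) (≤-respʳ (+-identityˡ (- a)) (+-mono-≤ (- a) a≤0))

  square-sum-zeroˡ : ∀ a b → a * a + b * b ≈ 0# → a * a ≈ 0#
  square-sum-zeroˡ a b sum≈0 = antisym aa≤0 (square-nonneg a)
    where
    aa≤0 : (a * a) ≤ 0#
    aa≤0 = ≤-respʳ (trans (+-comm (b * b) (a * a)) sum≈0) (≤-+-nonneg (square-nonneg b))

  square-sum-zeroʳ : ∀ a b → a * a + b * b ≈ 0# → b * b ≈ 0#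
  square-sum-zeroʳ a b sum≈0 = square-sum-zeroˡ b a (trans (+-comm (b * b) (a * a)) sum≈0)

  -- Classically a = 0; constructively we only get its double negation.
  square-zero : ∀ {a} → a * a ≈ 0# → ¬ ¬ (a ≈ 0#)
  square-zero aa≈0 a≉0 = *-nonzero a≉0 a≉0 aa≈0

  0≤1 : 0# ≤ 1#
  0≤1 = ≤-respʳ (*-identityˡ 1#) (square-nonneg 1#)

  1≤1+nonneg : ∀ {x} → 0# ≤ x → 1# ≤ (1# + x)
  1≤1+nonneg {x} 0≤x = ≤-respʳ (+-comm x 1#) (≤-+-nonneg 0≤x)

  fromℕ-nonneg : ∀ n → 0# ≤ fromℕ n
  fromℕ-nonneg zero    = ≤-refl
  fromℕ-nonneg (suc n) = ≤-respʳ (sym (1+× n 1#)) (≤-trans 0≤1 (1≤1+nonneg (fromℕ-nonneg n)))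

  fromℕ-suc≉0 : ∀ n → ¬ (fromℕ (suc n) ≈ 0#)
  fromℕ-suc≉0 n n+1≈0 = 0≉1 (antisym 0≤1 (≤-respʳ (trans (sym (1+× n 1#)) n+1≈0) (1≤1+nonneg (fromℕ-nonneg n))))

  -- To derive lhs ≈ rhs from s ≈ t it suffices that lhs ≈ rhs + (s - t)
  -- is a ring identity.
  by-equation : ∀ {lhs rhs s t} → lhs ≈ rhs + (s - t) → s ≈ t → lhs ≈ rhs
  by-equation {lhs} {rhs} {s} {t} identity s≈t = begin
    lhs            ≈⟨ identity ⟩
    rhs + (s - t)  ≈⟨ +-congˡ (+-congʳ s≈t) ⟩
    rhs + (t - t)  ≈⟨ +-congˡ (-‿inverseʳ t) ⟩
    rhs + 0#       ≈⟨ +-identityʳ rhs ⟩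
    rhs            ∎

  zero-combination : ∀ {x y} u v → x ≈ 0# → y ≈ 0# → x * u - y * v ≈ 0#
  zero-combination {x} {y} u v x≈0 y≈0 = begin
    x * u - y * v    ≈⟨ +-cong (*-congʳ x≈0) (-‿cong (*-congʳ y≈0)) ⟩
    0# * u - 0# * v  ≈⟨ solve 2 (λ u v → con (+ 0) :* u :- con (+ 0) :* v := con (+ 0)) refl u v ⟩
    0#               ∎

  sum-of-differences : ∀ {a b c d} → a ≈ b → c ≈ d → (a - b) + (c - d) ≈ 0#
  sum-of-differences {a} {b} {c} {d} a≈b c≈d = begin
    (a - b) + (c - d)  ≈⟨ +-cong (+-congʳ a≈b) (+-congʳ c≈d) ⟩
    (b - b) + (d - d)  ≈⟨ solve 2 (λ b d → (b :- b) :+ (d :- d) := con (+ 0)) refl b d ⟩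
    0#                 ∎

  difference-of-differences : ∀ {a b c d} → a ≈ b → c ≈ d → (a - b) - (c - d) ≈ 0#
  difference-of-differences {a} {b} {c} {d} a≈b c≈d = begin
    (a - b) - (c - d)  ≈⟨ +-cong (+-congʳ a≈b) (-‿cong (+-congʳ c≈d)) ⟩
    (b - b) - (d - d)  ≈⟨ solve 2 (λ b d → (b :- b) :- (d :- d) := con (+ 0)) refl b d ⟩
    0#                 ∎

  4≉1 : ¬ (fromℕ 4 ≈ 1#)
  4≉1 4≈1 = fromℕ-suc≉0 2 (begin
    fromℕ 3        ≈⟨ solve 0 (con (+ 3) := con (+ 4) :- con (+ 1)) refl ⟩
    fromℕ 4 - 1#   ≈⟨ +-congʳ 4≈1 ⟩
    1# - 1#        ≈⟨ -‿inverseʳ 1# ⟩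
    0#             ∎)

-- They are used both for points of F² and,
-- through the solver's polynomial syntax, for stating identities about them.
module PlaneOperations {a : Level} {A : Set a} (_⊕_ _⊗_ : A → A → A) (⊝_ : A → A) where
  infixl 6 _+ᵥ_ _-ᵥ_
  infix  7 _·_ _∧_

  Vector : Set a
  Vector = A Product.× A

  _+ᵥ_ _-ᵥ_ : Vector → Vector → Vector
  (a₁ , a₂) +ᵥ (b₁ , b₂) = (a₁ ⊕ b₁) , (a₂ ⊕ b₂)
  (a₁ , a₂) -ᵥ (b₁ , b₂) = (a₁ ⊕ (⊝ b₁)) , (a₂ ⊕ (⊝ b₂))

  _·_ _∧_ : Vector → Vector → A
  (a₁ , a₂) · (b₁ , b₂) = (a₁ ⊗ b₁) ⊕ (a₂ ⊗ b₂)
  (a₁ , a₂) ∧ (b₁ , b₂) = (a₁ ⊗ b₂) ⊕ (⊝ (a₂ ⊗ b₁))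

  ∥_∥² : Vector → A
  ∥ a ∥² = a · a

-- Plane geometry over an ordered field F.  Note that  dist² F p q  is by
-- definition  ∥ p -ᵥ q ∥².
module Plane {f ℓ : Level} (F : CompleteOrderedField f ℓ) where
  open CompleteOrderedField F
  open OrderedFieldFacts F
  open IntegerCoefficientSolver commRing using (solve; _:=_; _:+_; _:*_; _:-_; :-_; con)
  open PlaneOperations _+_ _*_ -_ public
  open import Algebra.Properties.Ring ring using (x∙y⁻¹≈ε⇒x≈y; x≈y⇒x∙y⁻¹≈ε)
  open import Relation.Binary.Reasoning.Setoid setoid

  module PolynomialSyntax {n : ℕ} = PlaneOperations (_:+_ {n}) _:*_ :-_
    renaming (_+ᵥ_ to _:+ᵥ_; _-ᵥ_ to _:-ᵥ_; _·_ to _:·_; _∧_ to _:∧_; ∥_∥² to :∥_∥²)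
  open PolynomialSyntax

  infix 4 _≈ᵥ_
  _≈ᵥ_ : Point F → Point F → Set ℓ
  _≈ᵥ_ = _≈ₚ_ F

  𝟎 : Point F
  𝟎 = 0# , 0#

  ≈ᵥ-sym : ∀ {p q} → p ≈ᵥ q → q ≈ᵥ p
  ≈ᵥ-sym (p₁≈q₁ , p₂≈q₂) = sym p₁≈q₁ , sym p₂≈q₂

  ·-cong : ∀ {a a′ b b′} → a ≈ᵥ a′ → b ≈ᵥ b′ → a · b ≈ a′ · b′
  ·-cong (a₁≈ , a₂≈) (b₁≈ , b₂≈) = +-cong (*-cong a₁≈ b₁≈) (*-cong a₂≈ b₂≈)

  ∥∥²-cong : ∀ {a b} → a ≈ᵥ b → ∥ a ∥² ≈ ∥ b ∥²
  ∥∥²-cong a≈b = ·-cong a≈b a≈b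

  ≈ᵥ⇒-ᵥ≈𝟎 : ∀ {p q} → p ≈ᵥ q → p -ᵥ q ≈ᵥ 𝟎
  ≈ᵥ⇒-ᵥ≈𝟎 (p₁≈q₁ , p₂≈q₂) = x≈y⇒x∙y⁻¹≈ε p₁≈q₁ , x≈y⇒x∙y⁻¹≈ε p₂≈q₂

  -ᵥ≈𝟎⇒≈ᵥ : ∀ {p q} → p -ᵥ q ≈ᵥ 𝟎 → p ≈ᵥ q
  -ᵥ≈𝟎⇒≈ᵥ (δ₁≈0 , δ₂≈0) = x∙y⁻¹≈ε⇒x≈y _ _ δ₁≈0 , x∙y⁻¹≈ε⇒x≈y _ _ δ₂≈0

  apart⇒dist²≉0 : ∀ {p q} → ¬ (p ≈ᵥ q) → ¬ (dist² F p q ≈ 0#)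
  apart⇒dist²≉0 {p₁ , p₂} {q₁ , q₂} p≉q d≈0 =
    square-zero (square-sum-zeroˡ (p₁ - q₁) (p₂ - q₂) d≈0) λ δ₁≈0 →
    square-zero (square-sum-zeroʳ (p₁ - q₁) (p₂ - q₂) d≈0) λ δ₂≈0 →
    p≉q (-ᵥ≈𝟎⇒≈ᵥ (δ₁≈0 , δ₂≈0))

  unit⇒apart : ∀ {p q} → dist² F p q ≈ 1# → ¬ (p ≈ᵥ q)
  unit⇒apart {p} {q} pq≈1 p≈q = 0≉1 (begin
    0#             ≈⟨ solve 0 (con (+ 0) := con (+ 0) :* con (+ 0) :+ con (+ 0) :* con (+ 0)) refl ⟩
    ∥ 𝟎 ∥²         ≈⟨ ∥∥²-cong (≈ᵥ-sym (≈ᵥ⇒-ᵥ≈𝟎 p≈q)) ⟩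
    dist² F p q    ≈⟨ pq≈1 ⟩
    1#             ∎)

  -- If d ≉ 0 is orthogonal to a and b, then a and b are parallel, by
  --   ∥d∥² (a ∧ b) = (d·a)(d ∧ b) - (d·b)(d ∧ a).
  orthogonal⇒parallel : ∀ {d a b} → ¬ (∥ d ∥² ≈ 0#) → d · a ≈ 0# → d · b ≈ 0# → a ∧ b ≈ 0#
  orthogonal⇒parallel {d} {a} {b} d≉0 d·a≈0 d·b≈0 =
    cancelˡ d≉0 (trans (identity d a b) (zero-combination (d ∧ b) (d ∧ a) d·a≈0 d·b≈0))
    where
    identity : ∀ d a b → ∥ d ∥² * (a ∧ b) ≈ (d · a) * (d ∧ b) - (d · b) * (d ∧ a)
    identity (d₁ , d₂) (a₁ , a₂) (b₁ , b₂) = solve 6 (λ d₁ d₂ a₁ a₂ b₁ b₂ →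
      let d = d₁ , d₂; a = a₁ , a₂; b = b₁ , b₂ in
      :∥ d ∥² :* (a :∧ b) := (d :· a) :* (d :∧ b) :- (d :· b) :* (d :∧ a)) refl d₁ d₂ a₁ a₂ b₁ b₂

  -- A vector both orthogonal and parallel to c ≉ 0 vanishes, by the
  -- decomposition  ∥c∥² e = (c·e) c + (c ∧ e) c⊥  with  c⊥ = (-c₂, c₁).
  orthogonal∧parallel⇒zero : ∀ {c e} → ¬ (∥ c ∥² ≈ 0#) → c · e ≈ 0# → c ∧ e ≈ 0# → e ≈ᵥ 𝟎
  orthogonal∧parallel⇒zero {c₁ , c₂} {e₁ , e₂} c≉0 c·e≈0 c∧e≈0 =
    cancelˡ c≉0 (trans first (zero-combination c₁ c₂ c·e≈0 c∧e≈0)) ,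
    cancelˡ c≉0 (trans second (zero-combination c₂ (- c₁) c·e≈0 c∧e≈0))
    where
    c e : Point F
    c = c₁ , c₂
    e = e₁ , e₂
    first : ∥ c ∥² * e₁ ≈ (c · e) * c₁ - (c ∧ e) * c₂
    first = solve 4 (λ c₁ c₂ e₁ e₂ → let c = c₁ , c₂; e = e₁ , e₂ in
      :∥ c ∥² :* e₁ := (c :· e) :* c₁ :- (c :∧ e) :* c₂) refl c₁ c₂ e₁ e₂
    second : ∥ c ∥² * e₂ ≈ (c · e) * c₂ - (c ∧ e) * (- c₁)
    second = solve 4 (λ c₁ c₂ e₁ e₂ → let c = c₁ , c₂; e = e₁ , e₂ in
      :∥ c ∥² :* e₂ := (c :· e) :* c₂ :- (c :∧ e) :* (:- c₁)) refl c₁ c₂ e₁ e₂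

  -- Polarisation: the products of  c = Z - X  and  d = Y - W  with each
  -- other and with  e = (Y + W) - (X + Z)  are combinations of the four
  -- squared distances between {X, Z} and {Y, W}.
  module RhombusIdentities (X Z Y W : Point F) where
    c d e : Point F
    c = Z -ᵥ X
    d = Y -ᵥ W
    e = (Y +ᵥ W) -ᵥ (X +ᵥ Z)

    d·c : fromℕ 2 * (d · c) ≈ (dist² F Y X - dist² F Y Z) - (dist² F W X - dist² F W Z)
    d·c = solve 8 (λ x₁ x₂ z₁ z₂ y₁ y₂ w₁ w₂ →
      let X = x₁ , x₂; Z = z₁ , z₂; Y = y₁ , y₂; W = w₁ , w₂ in
      con (+ 2) :* ((Y :-ᵥ W) :· (Z :-ᵥ X))
        := (:∥ Y :-ᵥ X ∥² :- :∥ Y :-ᵥ Z ∥²) :- (:∥ W :-ᵥ X ∥² :- :∥ W :-ᵥ Z ∥²))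
      refl (proj₁ X) (proj₂ X) (proj₁ Z) (proj₂ Z) (proj₁ Y) (proj₂ Y) (proj₁ W) (proj₂ W)

    d·e : fromℕ 2 * (d · e) ≈ (dist² F Y X - dist² F W X) + (dist² F Y Z - dist² F W Z)
    d·e = solve 8 (λ x₁ x₂ z₁ z₂ y₁ y₂ w₁ w₂ →
      let X = x₁ , x₂; Z = z₁ , z₂; Y = y₁ , y₂; W = w₁ , w₂ in
      con (+ 2) :* ((Y :-ᵥ W) :· ((Y :+ᵥ W) :-ᵥ (X :+ᵥ Z)))
        := (:∥ Y :-ᵥ X ∥² :- :∥ W :-ᵥ X ∥²) :+ (:∥ Y :-ᵥ Z ∥² :- :∥ W :-ᵥ Z ∥²))
      refl (proj₁ X) (proj₂ X) (proj₁ Z) (proj₂ Z) (proj₁ Y) (proj₂ Y) (proj₁ W) (proj₂ W)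

    c·e : fromℕ 2 * (c · e) ≈ (dist² F Y X - dist² F Y Z) + (dist² F W X - dist² F W Z)
    c·e = solve 8 (λ x₁ x₂ z₁ z₂ y₁ y₂ w₁ w₂ →
      let X = x₁ , x₂; Z = z₁ , z₂; Y = y₁ , y₂; W = w₁ , w₂ in
      con (+ 2) :* ((Z :-ᵥ X) :· ((Y :+ᵥ W) :-ᵥ (X :+ᵥ Z)))
        := (:∥ Y :-ᵥ X ∥² :- :∥ Y :-ᵥ Z ∥²) :+ (:∥ W :-ᵥ X ∥² :- :∥ W :-ᵥ Z ∥²))
      refl (proj₁ X) (proj₂ X) (proj₁ Z) (proj₂ Z) (proj₁ Y) (proj₂ Y) (proj₁ W) (proj₂ W)

  -- With the notation of RhombusIdentities: d ≉ 0 is orthogonal to c and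
  -- to e, so c ∥ e; and c ≉ 0 is orthogonal to e, so e = 0.
  rhombus : ∀ {X Z Y W r} → ¬ (X ≈ᵥ Z) → ¬ (Y ≈ᵥ W) →
            dist² F Y X ≈ r → dist² F Y Z ≈ r → dist² F W X ≈ r → dist² F W Z ≈ r →
            Y +ᵥ W ≈ᵥ X +ᵥ Z
  rhombus {X} {Z} {Y} {W} X≉Z Y≉W YX≈r YZ≈r WX≈r WZ≈r =
    -ᵥ≈𝟎⇒≈ᵥ (orthogonal∧parallel⇒zero c≉0 c·e≈0 c∧e≈0)
    where
    open RhombusIdentities X Z Y W
    2≉0 : ¬ (fromℕ 2 ≈ 0#)
    2≉0 = fromℕ-suc≉0 1
    YX≈YZ : dist² F Y X ≈ dist² F Y Z
    YX≈YZ = trans YX≈r (sym YZ≈r)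
    WX≈WZ : dist² F W X ≈ dist² F W Z
    WX≈WZ = trans WX≈r (sym WZ≈r)
    c≉0 : ¬ (∥ c ∥² ≈ 0#)
    c≉0 = apart⇒dist²≉0 (λ Z≈X → X≉Z (≈ᵥ-sym Z≈X))
    c·e≈0 : c · e ≈ 0#
    c·e≈0 = cancelˡ 2≉0 (trans c·e (sum-of-differences YX≈YZ WX≈WZ))
    c∧e≈0 : c ∧ e ≈ 0#
    c∧e≈0 = orthogonal⇒parallel (apart⇒dist²≉0 Y≉W)
      (cancelˡ 2≉0 (trans d·c (difference-of-differences YX≈YZ WX≈WZ)))
      (cancelˡ 2≉0 (trans d·e (sum-of-differences (trans YX≈r (sym WX≈r)) (trans YZ≈r (sym WZ≈r)))))

  -- Parallel vectors of equal length are equal or opposite: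
  --   ∥u - v∥² ∥u + v∥² = (∥u∥² - ∥v∥²)² + 4 (u ∧ v)².
  parallel-equal-length : ∀ {u v} → ∥ u ∥² ≈ ∥ v ∥² → u ∧ v ≈ 0# → ∥ u -ᵥ v ∥² * ∥ u +ᵥ v ∥² ≈ 0#
  parallel-equal-length {u₁ , u₂} {v₁ , v₂} ∥u∥≈∥v∥ u∧v≈0 = begin
    ∥ u -ᵥ v ∥² * ∥ u +ᵥ v ∥²                        ≈⟨ identity ⟩
    δ * δ + fromℕ 4 * ((u ∧ v) * (u ∧ v))            ≈⟨ +-cong (*-cong δ≈0 δ≈0) (*-congˡ (*-cong u∧v≈0 u∧v≈0)) ⟩
    0# * 0# + fromℕ 4 * (0# * 0#)                    ≈⟨ solve 0 (con (+ 0) :* con (+ 0) :+ con (+ 4) :* (con (+ 0) :* con (+ 0)) := con (+ 0)) refl ⟩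
    0#                                               ∎
    where
    u v : Point F
    u = u₁ , u₂
    v = v₁ , v₂
    δ : Carrier
    δ = ∥ u ∥² - ∥ v ∥²
    δ≈0 : δ ≈ 0#
    δ≈0 = trans (+-congʳ ∥u∥≈∥v∥) (-‿inverseʳ ∥ v ∥²)
    identity : ∥ u -ᵥ v ∥² * ∥ u +ᵥ v ∥² ≈ δ * δ + fromℕ 4 * ((u ∧ v) * (u ∧ v))
    identity = solve 4 (λ u₁ u₂ v₁ v₂ → let u = u₁ , u₂; v = v₁ , v₂ in
      :∥ u :-ᵥ v ∥² :* :∥ u :+ᵥ v ∥²
        := (:∥ u ∥² :- :∥ v ∥²) :* (:∥ u ∥² :- :∥ v ∥²) :+ con (+ 4) :* ((u :∧ v) :* (u :∧ v)))
      refl u₁ u₂ v₁ v₂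

  square-of-sum : ∀ a b → ∥ a +ᵥ b ∥² ≈ ∥ a ∥² + fromℕ 2 * (a · b) + ∥ b ∥²
  square-of-sum (a₁ , a₂) (b₁ , b₂) = solve 4 (λ a₁ a₂ b₁ b₂ → let a = a₁ , a₂; b = b₁ , b₂ in
    :∥ a :+ᵥ b ∥² := :∥ a ∥² :+ con (+ 2) :* (a :· b) :+ :∥ b ∥²) refl a₁ a₂ b₁ b₂

  -- Apollonius: the vector  (P - A) + (P - B)  is twice the median from P in
  -- the triangle PAB; its length and its product with A - B are given by
  -- the side lengths.
  apollonius : ∀ P A B → ∥ (P -ᵥ A) +ᵥ (P -ᵥ B) ∥² ≈ fromℕ 2 * (dist² F P A + dist² F P B) - dist² F A B
  apollonius (p₁ , p₂) (a₁ , a₂) (b₁ , b₂) = solve 6 (λ p₁ p₂ a₁ a₂ b₁ b₂ →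
    let P = p₁ , p₂; A = a₁ , a₂; B = b₁ , b₂ in
    :∥ (P :-ᵥ A) :+ᵥ (P :-ᵥ B) ∥² := con (+ 2) :* (:∥ P :-ᵥ A ∥² :+ :∥ P :-ᵥ B ∥²) :- :∥ A :-ᵥ B ∥²)
    refl p₁ p₂ a₁ a₂ b₁ b₂

  median·side : ∀ P A B → ((P -ᵥ A) +ᵥ (P -ᵥ B)) · (A -ᵥ B) ≈ dist² F P B - dist² F P A
  median·side (p₁ , p₂) (a₁ , a₂) (b₁ , b₂) = solve 6 (λ p₁ p₂ a₁ a₂ b₁ b₂ →
    let P = p₁ , p₂; A = a₁ , a₂; B = b₁ , b₂ in
    ((P :-ᵥ A) :+ᵥ (P :-ᵥ B)) :· (A :-ᵥ B) := :∥ P :-ᵥ B ∥² :- :∥ P :-ᵥ A ∥²)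
    refl p₁ p₂ a₁ a₂ b₁ b₂

  -- Reflecting Y in the line XZ gives P, reflecting Z in the line XY gives
  -- R (in a rhombus form  P + Y = X + Z,  R + Z = X + Y);  then P - R = 2 (Z - Y).
  opposite-reflections : ∀ {X Y Z P R} → P +ᵥ Y ≈ᵥ X +ᵥ Z → R +ᵥ Z ≈ᵥ X +ᵥ Y →
                         P -ᵥ R ≈ᵥ (Z -ᵥ Y) +ᵥ (Z -ᵥ Y)
  opposite-reflections (h₁ , h₂) (k₁ , k₂) = coordinate (+-cong h₁ (sym k₁)) , coordinate (+-cong h₂ (sym k₂))
    where
    coordinate : ∀ {x y z p r} → (p + y) + (x + y) ≈ (x + z) + (r + z) → p - r ≈ (z - y) + (z - y)
    coordinate {x} {y} {z} {p} {r} = by-equation (solve 5 (λ x y z p r →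
      p :- r := ((z :- y) :+ (z :- y)) :+ (((p :+ y) :+ (x :+ y)) :- ((x :+ z) :+ (r :+ z))))
      refl x y z p r)

  double-unit : ∀ {a} → ∥ a ∥² ≈ 1# → ∥ a +ᵥ a ∥² ≈ fromℕ 4
  double-unit {a} a≈1 = begin
    ∥ a +ᵥ a ∥²                              ≈⟨ square-of-sum a a ⟩
    ∥ a ∥² + fromℕ 2 * ∥ a ∥² + ∥ a ∥²      ≈⟨ +-cong (+-cong a≈1 (*-congˡ a≈1)) a≈1 ⟩
    1# + fromℕ 2 * 1# + 1#                   ≈⟨ solve 0 (con (+ 1) :+ con (+ 2) :* con (+ 1) :+ con (+ 1) := con (+ 4)) refl ⟩
    fromℕ 4                                  ∎

module ApexesOverUnitRhombus {f ℓ : Level} (F : CompleteOrderedField f ℓ) where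
  open CompleteOrderedField F
  open OrderedFieldFacts F
  open Plane F
  open IntegerCoefficientSolver commRing using (solve; _:=_; _:+_; _:*_; _:-_; con)
  open import Algebra.Properties.Ring ring using (x≈y⇒x∙y⁻¹≈ε)
  open import Relation.Binary.Reasoning.Setoid setoid

  translate : Point F → Point F → Point F → Point F
  translate R A C = R +ᵥ (A -ᵥ C)

  translate-A : ∀ R A C → translate R A C -ᵥ A ≈ᵥ R -ᵥ C
  translate-A (r₁ , r₂) (a₁ , a₂) (c₁ , c₂) = coordinate r₁ a₁ c₁ , coordinate r₂ a₂ c₂
    where
    coordinate : ∀ r a c → (r + (a - c)) - a ≈ r - c
    coordinate = solve 3 (λ r a c → (r :+ (a :- c)) :- a := r :- c) refl

  translate-B : ∀ {A B C D R} → B +ᵥ C ≈ᵥ A +ᵥ D → translate R A C -ᵥ B ≈ᵥ R -ᵥ D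
  translate-B (h₁ , h₂) = coordinate (sym h₁) , coordinate (sym h₂)
    where
    coordinate : ∀ {a b c d r} → a + d ≈ b + c → (r + (a - c)) - b ≈ r - d
    coordinate {a} {b} {c} {d} {r} = by-equation (solve 5 (λ a b c d r →
      (r :+ (a :- c)) :- b := (r :- d) :+ ((a :+ d) :- (b :+ c))) refl a b c d r)

  coincident-translate : ∀ {P R A C} → P ≈ᵥ translate R A C → P -ᵥ R ≈ᵥ A -ᵥ C
  coincident-translate (h₁ , h₂) = coordinate h₁ , coordinate h₂
    where
    coordinate : ∀ {p r a c} → p ≈ r + (a - c) → p - r ≈ a - c
    coordinate {p} {r} {a} {c} = by-equation (solve 4 (λ p r a c →
      p :- r := (a :- c) :+ (p :- (r :+ (a :- c)))) refl p r a c)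

  median+side : ∀ {P A B C R} → P +ᵥ translate R A C ≈ᵥ A +ᵥ B →
                ((P -ᵥ A) +ᵥ (P -ᵥ B)) +ᵥ (A -ᵥ C) ≈ᵥ P -ᵥ R
  median+side (h₁ , h₂) = coordinate h₁ , coordinate h₂
    where
    coordinate : ∀ {p a b c r} → p + (r + (a - c)) ≈ a + b → ((p - a) + (p - b)) + (a - c) ≈ p - r
    coordinate {p} {a} {b} {c} {r} = by-equation (solve 5 (λ p a b c r →
      ((p :- a) :+ (p :- b)) :+ (a :- c) := (p :- r) :+ ((p :+ (r :+ (a :- c))) :- (a :+ b))) refl p a b c r)

  difference-of-sides : ∀ A B C → (A -ᵥ B) -ᵥ (A -ᵥ C) ≈ᵥ C -ᵥ B
  difference-of-sides (a₁ , a₂) (b₁ , b₂) (c₁ , c₂) = coordinate a₁ b₁ c₁ , coordinate a₂ b₂ c₂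
    where
    coordinate : ∀ a b c → (a - b) - (a - c) ≈ c - b
    coordinate = solve 3 (λ a b c → (a :- b) :- (a :- c) := c :- b) refl

  sum-of-sides : ∀ {A B C D} → B +ᵥ C ≈ᵥ A +ᵥ D → (A -ᵥ B) +ᵥ (A -ᵥ C) ≈ᵥ A -ᵥ D
  sum-of-sides (h₁ , h₂) = coordinate (sym h₁) , coordinate (sym h₂)
    where
    coordinate : ∀ {a b c d} → a + d ≈ b + c → (a - b) + (a - c) ≈ a - d
    coordinate {a} {b} {c} {d} = by-equation (solve 4 (λ a b c d →
      (a :- b) :+ (a :- c) := (a :- d) :+ ((a :+ d) :- (b :+ c))) refl a b c d)

  -- The case where P and Q = R + (A - C) are distinct, so that P + Q = A + B
  -- by the rhombus lemma.  Then w = (P - A) + (P - B) has ∥w∥² = 3 and is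
  -- orthogonal to u = A - B and (as w + v = P - R has length 2) to v = A - C.
  -- Hence u ∥ v; as |u| = |v| this forces B = C or A = D.
  distinct-apexes : ∀ {A B C D P R} → B +ᵥ C ≈ᵥ A +ᵥ D → ¬ (A ≈ᵥ D) → ¬ (B ≈ᵥ C) →
                    dist² F A B ≈ 1# → dist² F A C ≈ 1# → dist² F P A ≈ 1# → dist² F P B ≈ 1# →
                    P +ᵥ translate R A C ≈ᵥ A +ᵥ B → ¬ (dist² F P R ≈ fromℕ 4)
  distinct-apexes {A} {B} {C} {D} {P} {R} B+C≈A+D A≉D B≉C AB≈1 AC≈1 PA≈1 PB≈1 P+Q≈A+B PR≈4 =
    *-nonzero (apart⇒dist²≉0 (λ C≈B → B≉C (≈ᵥ-sym C≈B))) (apart⇒dist²≉0 A≉D) (begin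
      dist² F C B * dist² F A D   ≈⟨ sym (*-cong (∥∥²-cong (difference-of-sides A B C)) (∥∥²-cong (sum-of-sides B+C≈A+D))) ⟩
      ∥ u -ᵥ v ∥² * ∥ u +ᵥ v ∥²   ≈⟨ parallel-equal-length (trans AB≈1 (sym AC≈1)) u∧v≈0 ⟩
      0#                          ∎)
    where
    u v w : Point F
    u = A -ᵥ B
    v = A -ᵥ C
    w = (P -ᵥ A) +ᵥ (P -ᵥ B)
    ∥w∥²≈3 : ∥ w ∥² ≈ fromℕ 3
    ∥w∥²≈3 = begin
      ∥ w ∥²                                                  ≈⟨ apollonius P A B ⟩
      fromℕ 2 * (dist² F P A + dist² F P B) - dist² F A B     ≈⟨ +-cong (*-congˡ (+-cong PA≈1 PB≈1)) (-‿cong AB≈1) ⟩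
      fromℕ 2 * (1# + 1#) - 1#                                ≈⟨ solve 0 (con (+ 2) :* (con (+ 1) :+ con (+ 1)) :- con (+ 1) := con (+ 3)) refl ⟩
      fromℕ 3                                                 ∎
    w·u≈0 : w · u ≈ 0#
    w·u≈0 = trans (median·side P A B) (x≈y⇒x∙y⁻¹≈ε (trans PB≈1 (sym PA≈1)))
    w·v≈0 : w · v ≈ 0#
    w·v≈0 = cancelˡ (fromℕ-suc≉0 1) (begin
      fromℕ 2 * (w · v)                                  ≈⟨ solve 3 (λ x y z → con (+ 2) :* y := (x :+ con (+ 2) :* y :+ z) :- x :- z) refl ∥ w ∥² (w · v) ∥ v ∥² ⟩
      (∥ w ∥² + fromℕ 2 * (w · v) + ∥ v ∥²) - ∥ w ∥² - ∥ v ∥²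
        ≈⟨ +-cong (+-cong (trans (sym (square-of-sum w v)) (trans (∥∥²-cong (median+side P+Q≈A+B)) PR≈4)) (-‿cong ∥w∥²≈3)) (-‿cong AC≈1) ⟩
      fromℕ 4 - fromℕ 3 - 1#                             ≈⟨ solve 0 (con (+ 4) :- con (+ 3) :- con (+ 1) := con (+ 0)) refl ⟩
      0#                                                 ∎)
    u∧v≈0 : u ∧ v ≈ 0#
    u∧v≈0 = orthogonal⇒parallel (λ w≈0 → fromℕ-suc≉0 2 (trans (sym ∥w∥²≈3) w≈0)) w·u≈0 w·v≈0

  apexes-not-at-distance-two : ∀ {A B C D P R} → B +ᵥ C ≈ᵥ A +ᵥ D → ¬ (A ≈ᵥ D) → ¬ (B ≈ᵥ C) →
                               dist² F A B ≈ 1# → dist² F A C ≈ 1# →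
                               dist² F P A ≈ 1# → dist² F P B ≈ 1# → dist² F R C ≈ 1# → dist² F R D ≈ 1# →
                               ¬ (dist² F P R ≈ fromℕ 4)
  apexes-not-at-distance-two {A} {B} {C} {D} {P} {R} B+C≈A+D A≉D B≉C AB≈1 AC≈1 PA≈1 PB≈1 RC≈1 RD≈1 PR≈4 =
    distinct-apexes B+C≈A+D A≉D B≉C AB≈1 AC≈1 PA≈1 PB≈1
      (rhombus (unit⇒apart AB≈1) P≉Q PA≈1 PB≈1 QA≈1 QB≈1) PR≈4
    where
    Q : Point F
    Q = translate R A C
    QA≈1 : dist² F Q A ≈ 1#
    QA≈1 = trans (∥∥²-cong (translate-A R A C)) RC≈1
    QB≈1 : dist² F Q B ≈ 1#
    QB≈1 = trans (∥∥²-cong (translate-B B+C≈A+D)) RD≈1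
    P≉Q : ¬ (P ≈ᵥ Q)
    P≉Q P≈Q = 4≉1 (begin
      fromℕ 4       ≈⟨ sym PR≈4 ⟩
      dist² F P R   ≈⟨ ∥∥²-cong (coincident-translate P≈Q) ⟩
      dist² F A C   ≈⟨ AC≈1 ⟩
      1#            ∎)

-- Adjacency in F(9,15,23) is decidable, so that edges can be found by the
-- type checker.
adjacent? : ∀ i j → Dec (Adj F-9-15-23 i j)
adjacent? i j = ((i , j) ∈? Graph.edges F-9-15-23) ⊎-dec ((j , i) ∈? Graph.edges F-9-15-23)

mainTheorem18 : (ℝ : CompleteOrderedField 0ℓ 0ℓ) → Forbidden ℝ F-9-15-23
mainTheorem18 ℝ (p , injective , unit) =
  apexes-not-at-distance-two rhombus-0132 (apart (# 0) (# 3) λ ()) (apart (# 1) (# 2) λ ())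
    (edge (# 0) (# 1)) (edge (# 0) (# 2)) (edge (# 5) (# 0)) (edge (# 5) (# 1))
    (edge (# 4) (# 2)) (edge (# 4) (# 3)) p₅p₄≈4
  where
  open CompleteOrderedField ℝ using (_≈_; 1#; trans)
  open OrderedFieldFacts ℝ using (fromℕ)
  open Plane ℝ
  open ApexesOverUnitRhombus ℝ using (apexes-not-at-distance-two)

  edge : ∀ i j → {True (adjacent? i j)} → dist² ℝ (p i) (p j) ≈ 1#
  edge i j {i~j} = unit i j (toWitness i~j)

  apart : ∀ i j → ¬ (i ≡ j) → ¬ (p i ≈ᵥ p j)
  apart i j i≢j pᵢ≈pⱼ = i≢j (injective i j pᵢ≈pⱼ)

  rhombus-0132 : p (# 1) +ᵥ p (# 2) ≈ᵥ p (# 0) +ᵥ p (# 3)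
  rhombus-0132 = rhombus (apart (# 0) (# 3) λ ()) (apart (# 1) (# 2) λ ())
    (edge (# 1) (# 0)) (edge (# 1) (# 3)) (edge (# 2) (# 0)) (edge (# 2) (# 3))

  rhombus-6587 : p (# 5) +ᵥ p (# 7) ≈ᵥ p (# 6) +ᵥ p (# 8)
  rhombus-6587 = rhombus (apart (# 6) (# 8) λ ()) (apart (# 5) (# 7) λ ())
    (edge (# 5) (# 6)) (edge (# 5) (# 8)) (edge (# 7) (# 6)) (edge (# 7) (# 8))

  rhombus-6478 : p (# 4) +ᵥ p (# 8) ≈ᵥ p (# 6) +ᵥ p (# 7)
  rhombus-6478 = rhombus (apart (# 6) (# 7) λ ()) (apart (# 4) (# 8) λ ())
    (edge (# 4) (# 6)) (edge (# 4) (# 7)) (edge (# 8) (# 6)) (edge (# 8) (# 7))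

  p₅p₄≈4 : dist² ℝ (p (# 5)) (p (# 4)) ≈ fromℕ 4
  p₅p₄≈4 = trans (∥∥²-cong (opposite-reflections rhombus-6587 rhombus-6478)) (double-unit (edge (# 8) (# 7)))
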